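{- For every integer $k>0$, the language $\mathtt{MODXOR}_k$ is recognized with zero error by an affine finite automaton with $2k+1$ states.
   Context: For $k>0$, $\mathtt{MODXOR}_k\subseteq\{0,1\}^*$ is the set of strings of the form $w_0\,x_1\,u_1\,x_2\,u_2\cdots x_m\,u_m$ where $m>0$, $w_0\in\{0,1\}^*$ has length less than $2k$, each $x_i\in\{0,1\}$, each $u_i\in\{0,1\}^{2k-1}$, and $x_1\oplus\cdots\oplus x_m=1$. An affine finite automaton (AfA) with states $E=\{e_1,\dots,e_m\}$ has an initial affine state $v_0\in\mathbb{R}^m$ (a real vector whose entries sum to $1$), a set of accepting states $E_a\subseteq E$, and for each input symbol (and optionally for a right end-marker read after the input) an affine operator, i.e. a real $m\times m$ matrix each of whose columns sums to $1$. On input $w$ the operators are applied in order to $v_0$ giving a final vector $v_f$, and the input is accepted with probability $\sum_{e_i\in E_a}|v_f[i]|/\|v_f\|_1$. It recognizes $L$ with zero error if members are accepted with probability $1$ and non-members with probability $0$. -}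

module Defs where

open import Data.Nat as ℕ using (ℕ; zero; suc; _<_)
open import Data.Fin using (Fin; zero; suc)
open import Data.Bool using (Bool; true; false; _xor_; if_then_else_)
open import Data.List using (List; []; _∷_; _++_; length; concatMap; map; foldr; foldl)
open import Data.List.Relation.Unary.All using (All)
open import Data.Maybe using (Maybe; just; nothing)
open import Data.Product using (Σ; _×_; _,_; proj₁; proj₂; ∃)
open import Data.Rational using (ℚ; 0ℚ; 1ℚ; _+_; _*_; ∣_∣; 1/_; _≟_; ≢-nonZero)
open import Relation.Nullary using (¬_; yes; no)
open import Relation.Binary.PropositionalEquality using (_≡_)

-- The language MODXOR_k over the alphabet {0,1} (0 = false, 1 = true)

-- a string x_1 u_1 ... x_m u_m is given by the list of pairs (x_i , u_i)
blockString : List (Bool × List Bool) → List Bool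
blockString = concatMap (λ b → proj₁ b ∷ proj₂ b)

xorAll : List Bool → Bool
xorAll = foldr _xor_ false

MODXOR : ℕ → List Bool → Set
MODXOR k w =
  Σ (List Bool) λ w₀ →
  Σ (List (Bool × List Bool)) λ blocks →
    (0 < length blocks)
  × (length w₀ < 2 ℕ.* k)
  × All (λ b → suc (length (proj₂ b)) ≡ 2 ℕ.* k) blocks
  × (w ≡ w₀ ++ blockString blocks)
  × (xorAll (map proj₁ blocks) ≡ true)

sumFin : ∀ {n} → (Fin n → ℚ) → ℚ
sumFin {zero}  f = 0ℚ
sumFin {suc n} f = f zero + sumFin (λ i → f (suc i))

Vector : ℕ → Set
Vector n = Fin n → ℚ

-- M i j = entry in row i, column j
Matrix : ℕ → Set
Matrix n = Fin n → Fin n → ℚ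

IsAffineState : ∀ {n} → Vector n → Set
IsAffineState v = sumFin v ≡ 1ℚ

IsAffineOperator : ∀ {n} → Matrix n → Set
IsAffineOperator {n} M = ∀ (j : Fin n) → sumFin (λ i → M i j) ≡ 1ℚ

apply : ∀ {n} → Matrix n → Vector n → Vector n
apply M v i = sumFin (λ j → M i j * v j)

record AfA (n : ℕ) : Set where
  field
    v₀        : Vector n
    v₀-affine : IsAffineState v₀
    accepting : Fin n → Bool
    op        : Bool → Matrix n
    op-affine : ∀ a → IsAffineOperator (op a)
    endOp     : Maybe (Matrix n)        -- optional right end-marker operator
    endOp-affine : ∀ {M} → endOp ≡ just M → IsAffineOperator M

  run : List Bool → Vector n → Vector n
  run []      v = v
  run (a ∷ w) v = run w (apply (op a) v)

  final : List Bool → Vector n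
  final w with endOp
  ... | nothing = run w v₀
  ... | just E  = apply E (run w v₀)

  norm1 : Vector n → ℚ
  norm1 v = sumFin (λ i → ∣ v i ∣)

  accMass : Vector n → ℚ
  accMass v = sumFin (λ i → if accepting i then ∣ v i ∣ else 0ℚ)

  -- acceptance probability  Σ_{e_i ∈ E_a} |v_f[i]| / ‖v_f‖₁
  -- (the norm is never 0 since entries of v_f sum to 1; the 0 branch is a dummy)
  acceptProb : List Bool → ℚ
  acceptProb w with norm1 (final w) ≟ 0ℚ
  ... | yes _  = 0ℚ
  ... | no n≢0 = accMass (final w) * (1/_ (norm1 (final w)) {{≢-nonZero n≢0}})

RecognizesZeroError : ∀ {n} → AfA n → (List Bool → Set) → Set
RecognizesZeroError A L =
  ∀ (w : List Bool) →
    (L w → AfA.acceptProb A w ≡ 1ℚ) × (¬ L w → AfA.acceptProb A w ≡ 0ℚ)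

-- The automaton keeps a cyclic register of 2k cells, each holding ±1, next to a single
-- accepting state that carries the remaining mass, so that the entries sum to 1.  Reading
-- a symbol a multiplies the cell at the head by (-1)^a and rotates the register by one
-- cell.  A cell thus passes the head exactly once every 2k steps, and at the end of the
-- input the head holds (-1)^(x₁ ⊕ ⋯ ⊕ xₘ), independently of the prefix w₀.  The
-- end-marker sends a state with head entry h to (1 - h)/2 on the accepting state and
-- (1 + h)/2 on a rejecting one; this is exactly the indicator of the correct answer.
module Submission where

open import Defs
open import Data.Nat using (ℕ; suc; _*_; _<_)
open import Data.Product using (Σ)

open import Algebra.Bundles using (CommutativeRing)
open import Data.Bool using (Bool; true; false; _xor_; if_then_else_)
open import Data.Bool.Properties using (if-eta)
open import Data.Empty using (⊥-elim)
open import Data.Fin using (Fin; zero; suc; toℕ; fromℕ; fromℕ<; inject₁)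
open import Data.Fin.Properties using (toℕ-inject₁; toℕ-fromℕ; toℕ-fromℕ<)
open import Data.List using (List; []; _∷_; _++_; length; map)
open import Data.List.Relation.Unary.All using (All; []; _∷_)
open import Data.Maybe using (just)
open import Data.Nat as ℕ using (zero; z<s)
import Data.Nat.Properties as ℕₚ
open import Data.Product using (_×_; _,_; proj₁; proj₂)
open import Data.Rational
  using (ℚ; 0ℚ; 1ℚ; ½; -_; _+_; _-_; ∣_∣; 1/_; _≟_; ≢-nonZero)
  renaming (_*_ to _·_)
open import Data.Rational.Properties
  using (+-*-commutativeRing; +-identityˡ; +-identityʳ; +-comm; *-identityˡ; *-identityʳ;
         *-zeroˡ; *-assoc; *-inverseʳ)
open import Data.Rational.Solver using (module +-*-Solver)
open import Function using (_∘_; _$_)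
open import Relation.Binary.PropositionalEquality
  using (_≡_; refl; sym; trans; cong; cong₂; module ≡-Reasoning)
open import Relation.Nullary using (¬_; yes; no)

open import Algebra.Properties.Semiring.Sum (CommutativeRing.semiring +-*-commutativeRing)
  using (sum; sum-cong-≗; sum-replicate-zero; sum-init-last; ∑-distrib-+; ∑-comm;
         *-distribˡ-sum; *-distribʳ-sum)

open ≡-Reasoning

sumFin≡sum : ∀ {n} (f : Fin n → ℚ) → sumFin f ≡ sum f
sumFin≡sum {zero}  f = refl
sumFin≡sum {suc n} f = cong (f zero +_) (sumFin≡sum (f ∘ suc))

sumFin-cong : ∀ {n} {f g : Fin n → ℚ} → (∀ i → f i ≡ g i) → sumFin f ≡ sumFin g
sumFin-cong {f = f} {g} f≗g =
  trans (sumFin≡sum f) (trans (sum-cong-≗ f≗g) (sym (sumFin≡sum g)))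

sumFin-zero : ∀ {n} {f : Fin n → ℚ} → (∀ i → f i ≡ 0ℚ) → sumFin f ≡ 0ℚ
sumFin-zero {n} {f} f≗0 =
  trans (sumFin≡sum f) (trans (sum-cong-≗ f≗0) (sum-replicate-zero n))

sumFin-+ : ∀ {n} (f g : Fin n → ℚ) → sumFin (λ i → f i + g i) ≡ sumFin f + sumFin g
sumFin-+ f g = begin
  sumFin (λ i → f i + g i) ≡⟨ sumFin≡sum (λ i → f i + g i) ⟩
  sum (λ i → f i + g i)    ≡⟨ ∑-distrib-+ f g ⟩
  sum f + sum g            ≡⟨ cong₂ _+_ (sumFin≡sum f) (sumFin≡sum g) ⟨
  sumFin f + sumFin g      ∎

sumFin-·ˡ : ∀ {n} c (f : Fin n → ℚ) → sumFin (λ i → c · f i) ≡ c · sumFin f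
sumFin-·ˡ c f = begin
  sumFin (λ i → c · f i) ≡⟨ sumFin≡sum (λ i → c · f i) ⟩
  sum (λ i → c · f i)    ≡⟨ *-distribˡ-sum c f ⟨
  c · sum f              ≡⟨ cong (c ·_) (sumFin≡sum f) ⟨
  c · sumFin f           ∎

sumFin-·ʳ : ∀ {n} c (f : Fin n → ℚ) → sumFin (λ i → f i · c) ≡ sumFin f · c
sumFin-·ʳ c f = begin
  sumFin (λ i → f i · c) ≡⟨ sumFin≡sum (λ i → f i · c) ⟩
  sum (λ i → f i · c)    ≡⟨ *-distribʳ-sum c f ⟨
  sum f · c              ≡⟨ cong (_· c) (sumFin≡sum f) ⟨
  sumFin f · c           ∎

apply-preserves-sum : ∀ {n} (M : Matrix n) → IsAffineOperator M →
                      ∀ v → sumFin (apply M v) ≡ sumFin v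
apply-preserves-sum M affine v = begin
  sumFin (apply M v)
    ≡⟨ sumFin≡sum (apply M v) ⟩
  sum (apply M v)
    ≡⟨ sum-cong-≗ (λ i → sumFin≡sum (λ j → M i j · v j)) ⟩
  sum (λ i → sum (λ j → M i j · v j))
    ≡⟨ ∑-comm (λ i j → M i j · v j) ⟩
  sum (λ j → sum (λ i → M i j · v j))
    ≡⟨ sum-cong-≗ (λ j → *-distribʳ-sum (v j) (λ i → M i j)) ⟨
  sum (λ j → sum (λ i → M i j) · v j)
    ≡⟨ sum-cong-≗ (λ j → cong (_· v j) (column-sum j)) ⟩
  sum (λ j → 1ℚ · v j)
    ≡⟨ sum-cong-≗ (*-identityˡ ∘ v) ⟩
  sum v
    ≡⟨ sumFin≡sum v ⟨
  sumFin v
    ∎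
  where
  column-sum : ∀ j → sum (λ i → M i j) ≡ 1ℚ
  column-sum j = trans (sym (sumFin≡sum (λ i → M i j))) (affine j)

δ : ∀ {n} → Fin n → Fin n → ℚ
δ zero    zero    = 1ℚ
δ zero    (suc _) = 0ℚ
δ (suc _) zero    = 0ℚ
δ (suc i) (suc j) = δ i j

δ-sym : ∀ {n} (i j : Fin n) → δ i j ≡ δ j i
δ-sym zero    zero    = refl
δ-sym zero    (suc _) = refl
δ-sym (suc _) zero    = refl
δ-sym (suc i) (suc j) = δ-sym i j

sumFin-δ : ∀ {n} (e : Fin n) (f : Fin n → ℚ → ℚ) → (∀ i → f i 0ℚ ≡ 0ℚ) →
           sumFin (λ i → f i (δ e i)) ≡ f e 1ℚ
sumFin-δ zero    f f·0≡0 =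
  trans (cong (f zero 1ℚ +_) (sumFin-zero (f·0≡0 ∘ suc))) (+-identityʳ _)
sumFin-δ (suc e) f f·0≡0 =
  trans (cong₂ _+_ (f·0≡0 zero) (sumFin-δ e (f ∘ suc) (f·0≡0 ∘ suc)))
        (+-identityˡ _)

sumFin-δ· : ∀ {n} (e : Fin n) (v : Fin n → ℚ) → sumFin (λ j → δ e j · v j) ≡ v e
sumFin-δ· e v = trans (sumFin-δ e (λ j x → x · v j) (*-zeroˡ ∘ v)) (*-identityˡ (v e))

sumFin-column-δ : ∀ {n} (j : Fin n) → sumFin (λ i → δ i j) ≡ 1ℚ
sumFin-column-δ j =
  trans (sumFin-cong (λ i → δ-sym i j)) (sumFin-δ j (λ _ x → x) (λ _ → refl))

module _ {n} (A : AfA n) where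
  open AfA A

  run-++ : ∀ x y v → run (x ++ y) v ≡ run y (run x v)
  run-++ []      y v = refl
  run-++ (a ∷ x) y v = run-++ x y (apply (op a) v)

  run-preserves-sum : ∀ w v → sumFin (run w v) ≡ sumFin v
  run-preserves-sum []      v = refl
  run-preserves-sum (a ∷ w) v =
    trans (run-preserves-sum w _) (apply-preserves-sum (op a) (op-affine a) v)

  acceptProb-normalised : ∀ w → norm1 (final w) ≡ 1ℚ →
                          acceptProb w ≡ accMass (final w)
  acceptProb-normalised w ‖f‖≡1 with norm1 (final w) ≟ 0ℚ
  ... | yes ‖f‖≡0 = ⊥-elim (1≢0 (trans (sym ‖f‖≡1) ‖f‖≡0))
    where
    1≢0 : ¬ 1ℚ ≡ 0ℚ
    1≢0 ()
  ... | no ‖f‖≢0 = begin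
    c · 1/N        ≡⟨ cong (_· 1/N) (*-identityʳ c) ⟨
    (c · 1ℚ) · 1/N ≡⟨ cong (λ x → (c · x) · 1/N) ‖f‖≡1 ⟨
    (c · N) · 1/N  ≡⟨ *-assoc c N 1/N ⟩
    c · (N · 1/N)  ≡⟨ cong (c ·_) (*-inverseʳ N {{≢-nonZero ‖f‖≢0}}) ⟩
    c · 1ℚ         ≡⟨ *-identityʳ c ⟩
    c              ∎
    where
    c N 1/N : ℚ
    c = accMass (final w)
    N = norm1 (final w)
    1/N = (1/ N) {{≢-nonZero ‖f‖≢0}}

  acceptProb-δ : ∀ w e → (∀ i → final w i ≡ δ e i) →
                 acceptProb w ≡ (if accepting e then 1ℚ else 0ℚ)
  acceptProb-δ w e final≗δ = begin
    acceptProb w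
      ≡⟨ acceptProb-normalised w ‖f‖≡1 ⟩
    accMass (final w)
      ≡⟨ sumFin-cong (λ i → cong (accEntry i) (final≗δ i)) ⟩
    sumFin (λ i → accEntry i (δ e i))
      ≡⟨ sumFin-δ e accEntry (λ i → if-eta (accepting i)) ⟩
    (if accepting e then 1ℚ else 0ℚ)
      ∎
    where
    accEntry : Fin n → ℚ → ℚ
    accEntry i x = if accepting i then ∣ x ∣ else 0ℚ
    ‖f‖≡1 : norm1 (final w) ≡ 1ℚ
    ‖f‖≡1 = trans (sumFin-cong (cong ∣_∣ ∘ final≗δ))
                  (sumFin-δ e (λ _ → ∣_∣) (λ _ → refl))

sgn : Bool → ℚ
sgn false = 1ℚ
sgn true  = - 1ℚ

sgn-xor : ∀ a b → sgn (a xor b) ≡ sgn a · sgn b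
sgn-xor false false = refl
sgn-xor false true  = refl
sgn-xor true  false = refl
sgn-xor true  true  = refl

sucMod : ∀ {m} → Fin (suc m) → Fin (suc m)
sucMod {zero}  zero    = zero
sucMod {suc m} zero    = suc zero
sucMod {suc m} (suc i) with sucMod i
... | zero  = zero
... | suc j = suc (suc j)

sucMod-inject₁ : ∀ {m} (i : Fin m) → sucMod (inject₁ i) ≡ suc i
sucMod-inject₁ {suc m} zero    = refl
sucMod-inject₁ {suc m} (suc i) rewrite sucMod-inject₁ i = refl

sucMod-fromℕ : ∀ m → sucMod (fromℕ m) ≡ zero
sucMod-fromℕ zero    = refl
sucMod-fromℕ (suc m) rewrite sucMod-fromℕ m = refl

sumFin-sucMod : ∀ {m} (g : Fin (suc m) → ℚ) → sumFin (g ∘ sucMod) ≡ sumFin g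
sumFin-sucMod {m} g = begin
  sumFin (g ∘ sucMod)                               ≡⟨ sumFin≡sum (g ∘ sucMod) ⟩
  sum (g ∘ sucMod)                                  ≡⟨ sum-init-last (g ∘ sucMod) ⟩
  sum (g ∘ sucMod ∘ inject₁) + g (sucMod (fromℕ m))
    ≡⟨ cong₂ _+_ (sum-cong-≗ (cong g ∘ sucMod-inject₁)) (cong g (sucMod-fromℕ m)) ⟩
  sum (g ∘ suc) + g zero                            ≡⟨ +-comm (sum (g ∘ suc)) (g zero) ⟩
  sum g                                             ≡⟨ sumFin≡sum g ⟨
  sumFin g                                          ∎

record Blocking (n : ℕ) (w : List Bool) : Set where
  constructor mkBlocking
  field
    prefix    : List Bool
    blocks    : List (Bool × List Bool)
    prefix<n  : length prefix < n
    blocks≡n  : All (λ b → suc (length (proj₂ b)) ≡ n) blocks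
    w≡        : w ≡ prefix ++ blockString blocks

  parity : Bool
  parity = xorAll (map proj₁ blocks)

open Blocking using (parity)

blocking : ∀ {n} → 0 < n → ∀ w → Blocking n w
blocking 0<n []      = mkBlocking [] [] 0<n [] refl
blocking {n} 0<n (a ∷ w) with blocking 0<n w
... | mkBlocking w₀ bs w₀<n bs≡n w≡ with suc (length w₀) ℕ.<? n
...   | yes aw₀<n = mkBlocking (a ∷ w₀) bs aw₀<n bs≡n (cong (a ∷_) w≡)
...   | no  aw₀≮n =
  mkBlocking [] ((a , w₀) ∷ bs) 0<n
             (ℕₚ.≤-antisym w₀<n (ℕₚ.≮⇒≥ aw₀≮n) ∷ bs≡n) (cong (a ∷_) w≡)

-- MODXOR k unfolds to PeriodicXOR (2 * k).
PeriodicXOR : ℕ → List Bool → Set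
PeriodicXOR n w =
  Σ (List Bool) λ w₀ →
  Σ (List (Bool × List Bool)) λ blocks →
    (0 < length blocks)
  × (length w₀ < n)
  × All (λ b → suc (length (proj₂ b)) ≡ n) blocks
  × (w ≡ w₀ ++ blockString blocks)
  × (xorAll (map proj₁ blocks) ≡ true)

PeriodicXOR⇒odd-blocking : ∀ {n w} → PeriodicXOR n w →
                           Σ (Blocking n w) λ d → parity d ≡ true
PeriodicXOR⇒odd-blocking (w₀ , bs , _ , w₀<n , bs≡n , w≡ , odd) =
  mkBlocking w₀ bs w₀<n bs≡n w≡ , odd

odd-blocking⇒PeriodicXOR : ∀ {n w} (d : Blocking n w) → parity d ≡ true → PeriodicXOR n w
odd-blocking⇒PeriodicXOR (mkBlocking w₀ bs w₀<n bs≡n w≡) odd =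
  w₀ , bs , nonempty bs odd , w₀<n , bs≡n , w≡ , odd
  where
  nonempty : ∀ bs → xorAll (map proj₁ bs) ≡ true → 0 < length bs
  nonempty []      ()
  nonempty (_ ∷ _) _ = z<s

x+0·y≡x : ∀ x y → x + 0ℚ · y ≡ x
x+0·y≡x x y = trans (cong (x +_) (*-zeroˡ y)) (+-identityʳ x)

-- The states are the accepting state zero and the cells suc c of a register with suc m
-- cells, whose cell zero is the head.
module ShiftRegister (m : ℕ) where
  open +-*-Solver

  State : Set
  State = Fin (suc (suc m))

  head : State
  head = suc zero

  -- The content of cell c + 1 moves to cell c, and that of the head to the last cell.
  source : State → State
  source zero    = zero
  source (suc c) = suc (sucMod c)

  -- Multiplying the head by sgn a moves (1 - sgn a) times its content to the accepting state.
  coef : Bool → State → ℚ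
  coef a zero          = 1ℚ - sgn a
  coef a (suc zero)    = sgn a - 1ℚ
  coef a (suc (suc _)) = 0ℚ

  step : Bool → Matrix (suc (suc m))
  step a i j = δ (source i) j + coef a (source i) · δ head j

  sumFin-source : ∀ (g : State → ℚ) → sumFin (g ∘ source) ≡ sumFin g
  sumFin-source g = cong (g zero +_) (sumFin-sucMod (g ∘ suc))

  sumFin-coef : ∀ a → sumFin (coef a) ≡ 0ℚ
  sumFin-coef a = begin
    (1ℚ - s) + ((s - 1ℚ) + sumFin {m} (λ _ → 0ℚ))
      ≡⟨ cong (λ t → (1ℚ - s) + ((s - 1ℚ) + t)) (sumFin-zero {m} (λ _ → refl)) ⟩
    (1ℚ - s) + ((s - 1ℚ) + 0ℚ)
      ≡⟨ solve 1 (λ s → (con 1ℚ :- s) :+ ((s :- con 1ℚ) :+ con 0ℚ) := con 0ℚ) refl s ⟩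
    0ℚ
      ∎
    where
    s : ℚ
    s = sgn a

  step-affine : ∀ a → IsAffineOperator (step a)
  step-affine a j = begin
    sumFin (λ i → step a i j)
      ≡⟨ sumFin-source column ⟩
    sumFin column
      ≡⟨ sumFin-+ (λ i → δ i j) (λ i → coef a i · δ head j) ⟩
    sumFin (λ i → δ i j) + sumFin (λ i → coef a i · δ head j)
      ≡⟨ cong₂ _+_ (sumFin-column-δ j) (sumFin-·ʳ (δ head j) (coef a)) ⟩
    1ℚ + sumFin (coef a) · δ head j
      ≡⟨ cong (λ t → 1ℚ + t · δ head j) (sumFin-coef a) ⟩
    1ℚ + 0ℚ · δ head j
      ≡⟨ x+0·y≡x 1ℚ (δ head j) ⟩
    1ℚ
      ∎
    where
    column : State → ℚ
    column i = δ i j + coef a i · δ head j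

  step-apply : ∀ a v i → apply (step a) v i ≡ v (source i) + coef a (source i) · v head
  step-apply a v i = begin
    sumFin (λ j → (δ s j + c · δ head j) · v j)
      ≡⟨ sumFin-cong distrib ⟩
    sumFin (λ j → δ s j · v j + c · (δ head j · v j))
      ≡⟨ sumFin-+ (λ j → δ s j · v j) (λ j → c · (δ head j · v j)) ⟩
    sumFin (λ j → δ s j · v j) + sumFin (λ j → c · (δ head j · v j))
      ≡⟨ cong₂ _+_ (sumFin-δ· s v) (sumFin-·ˡ c (λ j → δ head j · v j)) ⟩
    v s + c · sumFin (λ j → δ head j · v j)
      ≡⟨ cong (λ t → v s + c · t) (sumFin-δ· head v) ⟩
    v s + c · v head
      ∎
    where
    s : State
    s = source i
    c : ℚ
    c = coef a s
    distrib : ∀ j → (δ s j + c · δ head j) · v j ≡ δ s j · v j + c · (δ head j · v j)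
    distrib j = solve 4 (λ d c e x → (d :+ c :* e) :* x := d :* x :+ c :* (e :* x)) refl
                  (δ s j) c (δ head j) (v j)

  step-shift : ∀ a (c : Fin m) v → apply (step a) v (suc (inject₁ c)) ≡ v (suc (suc c))
  step-shift a c v = begin
    apply (step a) v (suc (inject₁ c))
      ≡⟨ step-apply a v (suc (inject₁ c)) ⟩
    v (suc (sucMod (inject₁ c))) + coef a (suc (sucMod (inject₁ c))) · v head
      ≡⟨ cong (λ t → v (suc t) + coef a (suc t) · v head) (sucMod-inject₁ c) ⟩
    v (suc (suc c)) + 0ℚ · v head
      ≡⟨ x+0·y≡x (v (suc (suc c))) (v head) ⟩
    v (suc (suc c))
      ∎

  step-wrap : ∀ a v → apply (step a) v (suc (fromℕ m)) ≡ v head · sgn a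
  step-wrap a v = begin
    apply (step a) v (suc (fromℕ m))
      ≡⟨ step-apply a v (suc (fromℕ m)) ⟩
    v (suc (sucMod (fromℕ m))) + coef a (suc (sucMod (fromℕ m))) · v head
      ≡⟨ cong (λ t → v (suc t) + coef a (suc t) · v head) (sucMod-fromℕ m) ⟩
    v head + (sgn a - 1ℚ) · v head
      ≡⟨ solve 2 (λ h s → h :+ (s :- con 1ℚ) :* h := h :* s) refl (v head) (sgn a) ⟩
    v head · sgn a
      ∎

  initial : Vector (suc (suc m))
  initial zero    = 1ℚ - sumFin {suc m} (λ _ → 1ℚ)
  initial (suc _) = 1ℚ

  initial-affine : IsAffineState initial
  initial-affine =
    solve 1 (λ r → (con 1ℚ :- r) :+ r := con 1ℚ) refl (sumFin {suc m} (λ _ → 1ℚ))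

  end : Matrix (suc (suc m))
  end zero          zero          = ½
  end zero          (suc zero)    = 0ℚ
  end zero          (suc (suc _)) = ½
  end (suc zero)    zero          = ½
  end (suc zero)    (suc zero)    = 1ℚ
  end (suc zero)    (suc (suc _)) = ½
  end (suc (suc _)) _             = 0ℚ

  end-affine : IsAffineOperator end
  end-affine j =
    trans (cong (λ t → end zero j + (end head j + t)) (sumFin-zero {m} (λ _ → refl)))
          (column j)
    where
    column : ∀ j → end zero j + (end head j + 0ℚ) ≡ 1ℚ
    column zero          = refl
    column (suc zero)    = refl
    column (suc (suc _)) = refl

  end-accept : ∀ v → apply end v zero ≡ ½ · (sumFin v - v head)
  end-accept v = begin
    ½ · v zero + (0ℚ · v head + sumFin (λ c → ½ · rest c))
      ≡⟨ cong (λ t → ½ · v zero + (0ℚ · v head + t)) (sumFin-·ˡ ½ rest) ⟩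
    ½ · v zero + (0ℚ · v head + ½ · r)
      ≡⟨ solve 3 (λ a h r → con ½ :* a :+ (con 0ℚ :* h :+ con ½ :* r)
                            := con ½ :* ((a :+ (h :+ r)) :- h)) refl (v zero) (v head) r ⟩
    ½ · ((v zero + (v head + r)) - v head)
      ∎
    where
    rest : Fin m → ℚ
    rest c = v (suc (suc c))
    r : ℚ
    r = sumFin rest

  end-reject : ∀ v → apply end v head ≡ ½ · (sumFin v + v head)
  end-reject v = begin
    ½ · v zero + (1ℚ · v head + sumFin (λ c → ½ · rest c))
      ≡⟨ cong (λ t → ½ · v zero + (1ℚ · v head + t)) (sumFin-·ˡ ½ rest) ⟩
    ½ · v zero + (1ℚ · v head + ½ · r)
      ≡⟨ solve 3 (λ a h r → con ½ :* a :+ (con 1ℚ :* h :+ con ½ :* r)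
                            := con ½ :* ((a :+ (h :+ r)) :+ h)) refl (v zero) (v head) r ⟩
    ½ · ((v zero + (v head + r)) + v head)
      ∎
    where
    rest : Fin m → ℚ
    rest c = v (suc (suc c))
    r : ℚ
    r = sumFin rest

  outcome : Bool → State
  outcome true  = zero
  outcome false = head

  end-outcome : ∀ v b → sumFin v ≡ 1ℚ → v head ≡ sgn b →
                ∀ i → apply end v i ≡ δ (outcome b) i
  end-outcome v b Σv≡1 h≡sgn zero = begin
    apply end v zero        ≡⟨ end-accept v ⟩
    ½ · (sumFin v - v head) ≡⟨ cong₂ (λ s h → ½ · (s - h)) Σv≡1 h≡sgn ⟩
    ½ · (1ℚ - sgn b)        ≡⟨ accept-entry b ⟩
    δ (outcome b) zero      ∎
    where
    accept-entry : ∀ b → ½ · (1ℚ - sgn b) ≡ δ (outcome b) zero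
    accept-entry true  = refl
    accept-entry false = refl
  end-outcome v b Σv≡1 h≡sgn (suc zero) = begin
    apply end v head        ≡⟨ end-reject v ⟩
    ½ · (sumFin v + v head) ≡⟨ cong₂ (λ s h → ½ · (s + h)) Σv≡1 h≡sgn ⟩
    ½ · (1ℚ + sgn b)        ≡⟨ head-entry b ⟩
    δ (outcome b) head      ∎
    where
    head-entry : ∀ b → ½ · (1ℚ + sgn b) ≡ δ (outcome b) head
    head-entry true  = refl
    head-entry false = refl
  end-outcome v b _ _ (suc (suc c)) =
    trans (sumFin-zero (λ j → *-zeroˡ (v j))) (other-entry b)
    where
    other-entry : ∀ b → 0ℚ ≡ δ (outcome b) (suc (suc c))
    other-entry true  = refl
    other-entry false = refl

  automaton : AfA (suc (suc m))
  automaton = record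
    { v₀           = initial
    ; v₀-affine    = initial-affine
    ; accepting    = λ { zero → true ; (suc _) → false }
    ; op           = step
    ; op-affine    = step-affine
    ; endOp        = just end
    ; endOp-affine = λ { refl → end-affine }
    }

  open AfA automaton using (run; accepting; acceptProb)

  run-head : ∀ (c : Fin (suc m)) u v → length u ≡ toℕ c → run u v head ≡ v (suc c)
  run-head zero    []      v _          = refl
  run-head zero    (_ ∷ _) _ ()
  run-head (suc _) []      _ ()
  run-head (suc c) (a ∷ u) v |au|≡1+c =
    trans (run-head (inject₁ c) u (apply (step a) v) |u|≡c) (step-shift a c v)
    where
    |u|≡c : length u ≡ toℕ (inject₁ c)
    |u|≡c = trans (ℕₚ.suc-injective |au|≡1+c) (sym (toℕ-inject₁ c))

  run-block : ∀ a u v → length u ≡ m → run (a ∷ u) v head ≡ v head · sgn a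
  run-block a u v |u|≡m =
    trans (run-head (fromℕ m) u (apply (step a) v) (trans |u|≡m (sym (toℕ-fromℕ m))))
          (step-wrap a v)

  run-blocks : ∀ bs v → All (λ b → suc (length (proj₂ b)) ≡ suc m) bs →
               run (blockString bs) v head ≡ v head · sgn (xorAll (map proj₁ bs))
  run-blocks []             v []             = sym (*-identityʳ (v head))
  run-blocks ((a , u) ∷ bs) v (|au|≡ ∷ bs≡) = begin
    run ((a ∷ u) ++ blockString bs) v head
      ≡⟨ cong (_$ head) (run-++ automaton (a ∷ u) (blockString bs) v) ⟩
    run (blockString bs) (run (a ∷ u) v) head
      ≡⟨ run-blocks bs (run (a ∷ u) v) bs≡ ⟩
    run (a ∷ u) v head · sgn p
      ≡⟨ cong (_· sgn p) (run-block a u v (ℕₚ.suc-injective |au|≡)) ⟩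
    (v head · sgn a) · sgn p
      ≡⟨ *-assoc (v head) (sgn a) (sgn p) ⟩
    v head · (sgn a · sgn p)
      ≡⟨ cong (v head ·_) (sgn-xor a p) ⟨
    v head · sgn (a xor p)
      ∎
    where
    p : Bool
    p = xorAll (map proj₁ bs)

  head-parity : ∀ {w} (d : Blocking (suc m) w) → run w initial head ≡ sgn (parity d)
  head-parity (mkBlocking w₀ bs w₀<n bs≡n refl) = begin
    run (w₀ ++ blockString bs) initial head
      ≡⟨ cong (_$ head) (run-++ automaton w₀ (blockString bs) initial) ⟩
    run (blockString bs) (run w₀ initial) head
      ≡⟨ run-blocks bs (run w₀ initial) bs≡n ⟩
    run w₀ initial head · sgn p
      ≡⟨ cong (_· sgn p) (run-head (fromℕ< w₀<n) w₀ initial (sym (toℕ-fromℕ< w₀<n))) ⟩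
    1ℚ · sgn p
      ≡⟨ *-identityˡ (sgn p) ⟩
    sgn p
      ∎
    where
    p : Bool
    p = xorAll (map proj₁ bs)

  acceptProb-parity : ∀ {w} (d : Blocking (suc m) w) →
                      acceptProb w ≡ (if parity d then 1ℚ else 0ℚ)
  acceptProb-parity {w} d = begin
    acceptProb w
      ≡⟨ acceptProb-δ automaton w (outcome b) final≗δ ⟩
    (if accepting (outcome b) then 1ℚ else 0ℚ)
      ≡⟨ cong (λ x → if x then 1ℚ else 0ℚ) (accepting-outcome b) ⟩
    (if b then 1ℚ else 0ℚ)
      ∎
    where
    b : Bool
    b = parity d
    final≗δ : ∀ i → apply end (run w initial) i ≡ δ (outcome b) i
    final≗δ = end-outcome (run w initial) b
                (trans (run-preserves-sum automaton w initial) initial-affine) (head-parity d)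
    accepting-outcome : ∀ b → accepting (outcome b) ≡ b
    accepting-outcome true  = refl
    accepting-outcome false = refl

  recognizes : RecognizesZeroError automaton (PeriodicXOR (suc m))
  recognizes w = accepts , rejects
    where
    accepts : PeriodicXOR (suc m) w → acceptProb w ≡ 1ℚ
    accepts w∈ with d , odd ← PeriodicXOR⇒odd-blocking w∈ =
      trans (acceptProb-parity d) (cong (λ x → if x then 1ℚ else 0ℚ) odd)
    rejects : ¬ PeriodicXOR (suc m) w → acceptProb w ≡ 0ℚ
    rejects w∉ with d ← blocking z<s w | parity d in parity≡
    ... | true  = ⊥-elim (w∉ (odd-blocking⇒PeriodicXOR d parity≡))
    ... | false = trans (acceptProb-parity d) (cong (λ x → if x then 1ℚ else 0ℚ) parity≡)

theorem12 : ∀ (k : ℕ) → 0 < k →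
    Σ (AfA (suc (2 * k))) λ A → RecognizesZeroError A (MODXOR k)
theorem12 zero    ()
theorem12 (suc k) _ = ShiftRegister.automaton _ , ShiftRegister.recognizes _
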